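{- A connected finite undirected simple graph $G=(V,E)$ contains a parity Hamiltonian cycle if and only if $|V|$ is even or $G$ is non-bipartite.
   Context: A closed walk is a sequence $v_0e_1v_1\cdots e_\ell v_\ell$ with $e_i=\{v_{i-1},v_i\}\in E$ and $v_\ell=v_0$; vertices and edges may be repeated. The visit number of a vertex $v$ is the number of indices $i\in\{1,\dots,\ell\}$ with $v_i=v$. A parity Hamiltonian cycle is a closed walk in which every vertex of $G$ has odd visit number. -}

module Defs where

open import Data.Nat using (ℕ; zero; suc; _+_)
open import Data.Nat.Divisibility using (_∣_)
open import Data.Fin using (Fin)
open import Data.Fin.Properties using (_≟_)
open import Data.Bool using (Bool; true; false)
open import Data.List using (List; []; _∷_; last)
open import Data.Maybe using (just)
open import Data.Product using (Σ; _×_; ∃; ∃-syntax)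
open import Relation.Binary.PropositionalEquality using (_≡_; _≢_)
open import Relation.Nullary using (¬_; yes; no)

record Graph (n : ℕ) : Set where
  field
    adj   : Fin n → Fin n → Bool
    sym   : ∀ u v → adj u v ≡ adj v u
    irrefl : ∀ v → adj v v ≡ false

open Graph public

Edge : {n : ℕ} → Graph n → Fin n → Fin n → Set
Edge G u v = adj G u v ≡ true

data Walk {n : ℕ} (G : Graph n) : Fin n → Fin n → Set where
  [_] : (v : Fin n) → Walk G v v
  _∷⟨_⟩_ : (u : Fin n) {w v : Fin n} → Edge G u w → Walk G w v → Walk G u v

Connected : {n : ℕ} → Graph n → Set
Connected G = ∀ u v → Walk G u v

Bipartite : {n : ℕ} → Graph n → Set
Bipartite {n} G = Σ (Fin n → Bool) λ c → ∀ u v → Edge G u v → c u ≢ c v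

occ : {n : ℕ} → Fin n → {G : Graph n} {u v : Fin n} → Walk G u v → ℕ
occ x [ v ] with x ≟ v
... | yes _ = 1
... | no  _ = 0
occ x (u ∷⟨ e ⟩ p) with x ≟ u
... | yes _ = suc (occ x p)
... | no  _ = occ x p

-- visit number: number of indices i ∈ {1,…,ℓ} with v_i = x
-- (the starting vertex v₀ is not counted)
visits : {n : ℕ} → Fin n → {G : Graph n} {u v : Fin n} → Walk G u v → ℕ
visits x [ v ] = 0
visits x (u ∷⟨ e ⟩ p) = occ x p

Even : ℕ → Set
Even m = 2 ∣ m

Odd : ℕ → Set
Odd m = ¬ (2 ∣ m)

HasParityHamiltonianCycle : {n : ℕ} → Graph n → Set
HasParityHamiltonianCycle {n} G =
  Σ (Fin n) λ v₀ → Σ (Walk G v₀ v₀) λ W → ∀ x → Odd (visits x W)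

-- Modulo 2, the visit numbers of a walk add up to its length, since every step visits exactly
-- one vertex. If all |V| visit numbers are odd, the closed walk therefore has length ≡ |V|,
-- whereas closed walks in a bipartite graph have even length. Conversely, fix a vertex b and a
-- closed walk at b of length ≡ |V|: the trivial walk when |V| is even, and otherwise an odd
-- closed walk, which exists in a connected non-bipartite graph. Appending a round trip
-- b ⇝ x ⇝ b keeps the length even and flips the visit parity of x and b only, so every x ≠ b
-- can be made odd; the length then forces the visit number of b to be odd as well.
module Submission where

open import Defs hiding (sym)
open import Defs using () renaming (sym to adj-sym)
open import Data.Bool using (Bool; true; false)
import Data.Bool as Bool
open import Data.Empty using (⊥-elim)
open import Data.Fin using (Fin; zero; suc; punchIn)
open import Data.Fin.Properties using (_≟_; any?; punchInᵢ≢i)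
open import Data.List using (List; []; _∷_; allFin)
open import Data.List.Membership.Propositional using (_∈_)
open import Data.List.Membership.Propositional.Properties using (∈-allFin)
open import Data.List.Relation.Unary.Any using (here; there)
open import Data.Nat as ℕ using (ℕ; zero; suc; parity)
import Data.Nat.Properties as ℕ
open import Data.Nat.Divisibility using (divides)
open import Data.Parity.Base as ℙ using (Parity; 0ℙ; 1ℙ; _+_; _*_)
open import Data.Parity.Properties as ℙ
  using (+-homo-+; *-homo-*; p+p≡0ℙ; *-zeroʳ; *-identityʳ; *-distribʳ-+; +-cancelʳ-≡)
open import Data.Product using (Σ; _×_; _,_)
open import Data.Sum using (_⊎_; inj₁; inj₂)
open import Function.Base using (_∘_; case_of_)
open import Function.Bundles using (_⇔_; mk⇔)
open import Relation.Binary.PropositionalEquality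
open import Relation.Nullary using (¬_; yes; no)
open import Relation.Nullary.Decidable using (_×-dec_)
open import Algebra.Definitions.RawMonoid ℙ.+-0-rawMonoid using () renaming (_×_ to _·_)
open import Algebra.Properties.CommutativeMonoid.Sum ℙ.+-0-commutativeMonoid
  using (sum-syntax; sum-cong-≗; ∑-distrib-+; sum-remove; sum-replicate; sum-replicate-zero)
open import Algebra.Properties.CommutativeSemigroup ℙ.+-commutativeSemigroup
  using (interchange; x∙yz≈y∙xz)

even⇒parity≡0ℙ : ∀ {m} → Even m → parity m ≡ 0ℙ
even⇒parity≡0ℙ (divides q refl) = trans (*-homo-* q 2) (*-zeroʳ (parity q))

parity≡0ℙ⇒even : ∀ m → parity m ≡ 0ℙ → Even m
parity≡0ℙ⇒even zero          _  = divides 0 refl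
parity≡0ℙ⇒even (suc (suc m)) eq with parity≡0ℙ⇒even m eq
... | divides q m≡q*2 = divides (suc q) (cong (λ k → suc (suc k)) m≡q*2)

parity≡1ℙ⇒odd : ∀ {m} → parity m ≡ 1ℙ → Odd m
parity≡1ℙ⇒odd eq even with () ← trans (sym eq) (even⇒parity≡0ℙ even)

odd⇒parity≡1ℙ : ∀ m → Odd m → parity m ≡ 1ℙ
odd⇒parity≡1ℙ m odd with parity m in eq
... | 1ℙ = refl
... | 0ℙ = ⊥-elim (odd (parity≡0ℙ⇒even m eq))

·-parity : ∀ n p → n · p ≡ parity n * p
·-parity zero    p = refl
·-parity (suc n) p = begin
  p + n · p             ≡⟨ cong (p +_) (·-parity n p) ⟩
  p + (parity n * p)    ≡⟨ *-distribʳ-+ p 1ℙ (parity n) ⟨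
  (1ℙ + parity n) * p   ≡⟨ cong (_* p) (+-homo-+ 1 n) ⟨
  parity (suc n) * p    ∎
  where open ≡-Reasoning

+-cancel-middle : ∀ p q r → (p + q) + (q + r) ≡ p + r
+-cancel-middle p q r = begin
  (p + q) + (q + r)   ≡⟨ ℙ.+-assoc p q (q + r) ⟩
  p + (q + (q + r))   ≡⟨ cong (p +_) (ℙ.+-assoc q q r) ⟨
  p + ((q + q) + r)   ≡⟨ cong (λ s → p + (s + r)) (p+p≡0ℙ q) ⟩
  p + r               ∎
  where open ≡-Reasoning

fromBool : Bool → Parity
fromBool false = 0ℙ
fromBool true  = 1ℙ

fromBool-≢ : ∀ {b b′} → b ≢ b′ → fromBool b + fromBool b′ ≡ 1ℙ
fromBool-≢ {false} {false} b≢b′ = ⊥-elim (b≢b′ refl)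
fromBool-≢ {false} {true}  _    = refl
fromBool-≢ {true}  {false} _    = refl
fromBool-≢ {true}  {true}  b≢b′ = ⊥-elim (b≢b′ refl)

toBool : Parity → Bool
toBool 0ℙ = false
toBool 1ℙ = true

toBool-injective : ∀ {p q} → toBool p ≡ toBool q → p ≡ q
toBool-injective {0ℙ} {0ℙ} _ = refl
toBool-injective {1ℙ} {1ℙ} _ = refl

∑-constantExcept : ∀ {n} (f : Fin (suc n) → Parity) (i : Fin (suc n)) c →
  (∀ j → j ≢ i → f j ≡ c) → ∑[ j < suc n ] f j ≡ f i + (parity n * c)
∑-constantExcept {n} f i c f≡c = begin
  ∑[ j < suc n ] f j                 ≡⟨ sum-remove {i = i} f ⟩
  f i + ∑[ j < n ] f (punchIn i j)   ≡⟨ cong (f i +_) (sum-cong-≗ (λ j → f≡c _ (punchInᵢ≢i i j))) ⟩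
  f i + ∑[ j < n ] c                 ≡⟨ cong (f i +_) (trans (sum-replicate n) (·-parity n c)) ⟩
  f i + (parity n * c)               ∎
  where open ≡-Reasoning

∑-indicator : ∀ {n} (f : Fin n → Parity) (i : Fin n) →
  f i ≡ 1ℙ → (∀ j → j ≢ i → f j ≡ 0ℙ) → ∑[ j < n ] f j ≡ 1ℙ
∑-indicator {suc n} f i fi≡1ℙ f≡0ℙ = begin
  ∑[ j < suc n ] f j      ≡⟨ ∑-constantExcept f i 0ℙ f≡0ℙ ⟩
  f i + (parity n * 0ℙ)   ≡⟨ cong₂ _+_ fi≡1ℙ (*-zeroʳ (parity n)) ⟩
  1ℙ                      ∎
  where open ≡-Reasoning

module _ {n : ℕ} {G : Graph n} where

  Edge-sym : ∀ {u v} → Edge G u v → Edge G v u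
  Edge-sym {u} {v} e = trans (adj-sym G v u) e

  length : ∀ {u v} → Walk G u v → ℕ
  length [ v ]        = 0
  length (u ∷⟨ e ⟩ p) = suc (length p)

  infixr 5 _++ʷ_

  _++ʷ_ : ∀ {a b c} → Walk G a b → Walk G b c → Walk G a c
  [ v ]        ++ʷ q = q
  (u ∷⟨ e ⟩ p) ++ʷ q = u ∷⟨ e ⟩ (p ++ʷ q)

  reverse : ∀ {u v} → Walk G u v → Walk G v u
  reverse [ v ]              = [ v ]
  reverse (_∷⟨_⟩_ u {w} e p) = reverse p ++ʷ (w ∷⟨ Edge-sym e ⟩ [ u ])

  roundTrip : ∀ {a b} → Walk G a b → Walk G a a
  roundTrip p = p ++ʷ reverse p

  length-++ : ∀ {a b c} (p : Walk G a b) (q : Walk G b c) →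
    length (p ++ʷ q) ≡ length p ℕ.+ length q
  length-++ [ v ]        q = refl
  length-++ (u ∷⟨ e ⟩ p) q = cong suc (length-++ p q)

  length-reverse : ∀ {u v} (p : Walk G u v) → length (reverse p) ≡ length p
  length-reverse [ v ]        = refl
  length-reverse (u ∷⟨ e ⟩ p) = begin
    length (reverse p ++ʷ _)   ≡⟨ length-++ (reverse p) _ ⟩
    length (reverse p) ℕ.+ 1   ≡⟨ cong (ℕ._+ 1) (length-reverse p) ⟩
    length p ℕ.+ 1             ≡⟨ ℕ.+-comm (length p) 1 ⟩
    suc (length p)             ∎
    where open ≡-Reasoning

  parity-length-roundTrip : ∀ {a b} (p : Walk G a b) → parity (length (roundTrip p)) ≡ 0ℙ
  parity-length-roundTrip p = begin
    parity (length (p ++ʷ reverse p))          ≡⟨ cong parity (length-++ p (reverse p)) ⟩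
    parity (length p ℕ.+ length (reverse p))   ≡⟨ cong (λ k → parity (length p ℕ.+ k)) (length-reverse p) ⟩
    parity (length p ℕ.+ length p)             ≡⟨ +-homo-+ (length p) (length p) ⟩
    parity (length p) + parity (length p)      ≡⟨ p+p≡0ℙ (parity (length p)) ⟩
    0ℙ                                         ∎
    where open ≡-Reasoning

  δ : Fin n → Fin n → ℕ
  δ y v = occ y {G} [ v ]

  δ-≡ : ∀ v → δ v v ≡ 1
  δ-≡ v with v ≟ v
  ... | yes _  = refl
  ... | no v≢v = ⊥-elim (v≢v refl)

  δ-≢ : ∀ {y v} → y ≢ v → δ y v ≡ 0
  δ-≢ {y} {v} y≢v with y ≟ v
  ... | yes y≡v = ⊥-elim (y≢v y≡v)
  ... | no _    = refl

  occ-∷ : ∀ y u {w v} (e : Edge G u w) (p : Walk G w v) →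
    occ y (u ∷⟨ e ⟩ p) ≡ δ y u ℕ.+ occ y p
  occ-∷ y u e p with y ≟ u
  ... | yes _ = refl
  ... | no _  = refl

  occ≡δ+visits : ∀ y {a b} (p : Walk G a b) → occ y p ≡ δ y a ℕ.+ visits y p
  occ≡δ+visits y [ v ]        = sym (ℕ.+-identityʳ _)
  occ≡δ+visits y (u ∷⟨ e ⟩ p) = occ-∷ y u e p

  occ-++ : ∀ y {a b c} (p : Walk G a b) (q : Walk G b c) →
    occ y (p ++ʷ q) ≡ occ y p ℕ.+ visits y q
  occ-++ y [ v ]        q = occ≡δ+visits y q
  occ-++ y (u ∷⟨ e ⟩ p) q = begin
    occ y (u ∷⟨ e ⟩ (p ++ʷ q))           ≡⟨ occ-∷ y u e (p ++ʷ q) ⟩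
    δ y u ℕ.+ occ y (p ++ʷ q)            ≡⟨ cong (δ y u ℕ.+_) (occ-++ y p q) ⟩
    δ y u ℕ.+ (occ y p ℕ.+ visits y q)   ≡⟨ ℕ.+-assoc (δ y u) _ _ ⟨
    (δ y u ℕ.+ occ y p) ℕ.+ visits y q   ≡⟨ cong (ℕ._+ visits y q) (occ-∷ y u e p) ⟨
    occ y (u ∷⟨ e ⟩ p) ℕ.+ visits y q    ∎
    where open ≡-Reasoning

  visits-++ : ∀ y {a b c} (p : Walk G a b) (q : Walk G b c) →
    visits y (p ++ʷ q) ≡ visits y p ℕ.+ visits y q
  visits-++ y [ v ]        q = refl
  visits-++ y (u ∷⟨ e ⟩ p) q = occ-++ y p q

  occ-reverse : ∀ y {a b} (p : Walk G a b) → occ y (reverse p) ≡ occ y p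
  occ-reverse y [ v ]              = refl
  occ-reverse y (_∷⟨_⟩_ u {w} e p) = begin
    occ y (reverse p ++ʷ (w ∷⟨ Edge-sym e ⟩ [ u ]))   ≡⟨ occ-++ y (reverse p) _ ⟩
    occ y (reverse p) ℕ.+ δ y u                       ≡⟨ cong (ℕ._+ δ y u) (occ-reverse y p) ⟩
    occ y p ℕ.+ δ y u                                 ≡⟨ ℕ.+-comm (occ y p) _ ⟩
    δ y u ℕ.+ occ y p                                 ≡⟨ occ-∷ y u e p ⟨
    occ y (u ∷⟨ e ⟩ p)                                ∎
    where open ≡-Reasoning

  parity-visits : ∀ y {a b} (p : Walk G a b) →
    parity (visits y p) ≡ parity (δ y a) + parity (occ y p)
  parity-visits y {a} p = begin
    parity (visits y p)                  ≡⟨ cong (_+ parity (visits y p)) (p+p≡0ℙ d) ⟨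
    (d + d) + parity (visits y p)        ≡⟨ ℙ.+-assoc d d _ ⟩
    d + (d + parity (visits y p))        ≡⟨ cong (d +_) (+-homo-+ (δ y a) (visits y p)) ⟨
    d + parity (δ y a ℕ.+ visits y p)    ≡⟨ cong (λ k → d + parity k) (occ≡δ+visits y p) ⟨
    d + parity (occ y p)                 ∎
    where
    open ≡-Reasoning
    d = parity (δ y a)

  parity-visits-roundTrip : ∀ y {a b} (p : Walk G a b) →
    parity (visits y (roundTrip p)) ≡ parity (δ y a) + parity (δ y b)
  parity-visits-roundTrip y {a} {b} p = begin
    parity (visits y (p ++ʷ reverse p))
      ≡⟨ cong parity (visits-++ y p (reverse p)) ⟩
    parity (visits y p ℕ.+ visits y (reverse p))
      ≡⟨ +-homo-+ (visits y p) _ ⟩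
    parity (visits y p) + parity (visits y (reverse p))
      ≡⟨ cong₂ _+_ (parity-visits y p) (parity-visits y (reverse p)) ⟩
    (A + O) + (B + parity (occ y (reverse p)))
      ≡⟨ cong (λ k → (A + O) + (B + parity k)) (occ-reverse y p) ⟩
    (A + O) + (B + O)
      ≡⟨ interchange A O B O ⟩
    (A + B) + (O + O)
      ≡⟨ cong ((A + B) +_) (p+p≡0ℙ O) ⟩
    (A + B) + 0ℙ
      ≡⟨ ℙ.+-identityʳ (A + B) ⟩
    A + B
      ∎
    where
    open ≡-Reasoning
    A = parity (δ y a)
    B = parity (δ y b)
    O = parity (occ y p)

  ∑-parity-δ : ∀ v → ∑[ y < n ] parity (δ y v) ≡ 1ℙ
  ∑-parity-δ v = ∑-indicator _ v (cong parity (δ-≡ v)) (λ y y≢v → cong parity (δ-≢ y≢v))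

  ∑-parity-occ : ∀ {a b} (p : Walk G a b) → ∑[ y < n ] parity (occ y p) ≡ parity (suc (length p))
  ∑-parity-occ [ v ]        = ∑-parity-δ v
  ∑-parity-occ (u ∷⟨ e ⟩ p) = begin
    ∑[ y < n ] parity (occ y (u ∷⟨ e ⟩ p))
      ≡⟨ sum-cong-≗ (λ y → trans (cong parity (occ-∷ y u e p)) (+-homo-+ (δ y u) (occ y p))) ⟩
    ∑[ y < n ] (parity (δ y u) + parity (occ y p))
      ≡⟨ ∑-distrib-+ (λ y → parity (δ y u)) (λ y → parity (occ y p)) ⟩
    ∑[ y < n ] parity (δ y u) + ∑[ y < n ] parity (occ y p)
      ≡⟨ cong₂ _+_ (∑-parity-δ u) (∑-parity-occ p) ⟩
    1ℙ + parity (suc (length p))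
      ≡⟨ +-homo-+ 1 (suc (length p)) ⟨
    parity (suc (suc (length p)))
      ∎
    where open ≡-Reasoning

  ∑-parity-visits : ∀ {a b} (p : Walk G a b) → ∑[ y < n ] parity (visits y p) ≡ parity (length p)
  ∑-parity-visits [ v ]        = sum-replicate-zero n
  ∑-parity-visits (u ∷⟨ e ⟩ p) = ∑-parity-occ p

  parity-length-oddVisits : ∀ {a b} (p : Walk G a b) → (∀ x → Odd (visits x p)) →
    parity (length p) ≡ parity n
  parity-length-oddVisits p odd = begin
    parity (length p)                ≡⟨ ∑-parity-visits p ⟨
    ∑[ y < n ] parity (visits y p)   ≡⟨ sum-cong-≗ (λ y → odd⇒parity≡1ℙ _ (odd y)) ⟩
    ∑[ y < n ] 1ℙ                    ≡⟨ sum-replicate n ⟩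
    n · 1ℙ                           ≡⟨ ·-parity n 1ℙ ⟩
    parity n * 1ℙ                    ≡⟨ *-identityʳ (parity n) ⟩
    parity n                         ∎
    where open ≡-Reasoning

  parity-length-properColouring : (κ : Fin n → Parity) → (∀ u v → Edge G u v → κ u + κ v ≡ 1ℙ) →
    ∀ {u v} (p : Walk G u v) → parity (length p) ≡ κ u + κ v
  parity-length-properColouring κ proper [ v ]                  = sym (p+p≡0ℙ (κ v))
  parity-length-properColouring κ proper (_∷⟨_⟩_ u {w} {v} e p) = begin
    parity (suc (length p))     ≡⟨ +-homo-+ 1 (length p) ⟩
    1ℙ + parity (length p)      ≡⟨ cong₂ _+_ (sym (proper u w e)) (parity-length-properColouring κ proper p) ⟩
    (κ u + κ w) + (κ w + κ v)   ≡⟨ +-cancel-middle (κ u) (κ w) (κ v) ⟩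
    κ u + κ v                   ∎
    where open ≡-Reasoning

  bipartite⇒parity-length-closed≡0ℙ : Bipartite G → ∀ {b} (W : Walk G b b) → parity (length W) ≡ 0ℙ
  bipartite⇒parity-length-closed≡0ℙ (c , proper) {b} W =
    trans (parity-length-properColouring (fromBool ∘ c) (λ u v e → fromBool-≢ (proper u v e)) W)
          (p+p≡0ℙ (fromBool (c b)))

  parity-visits-++-roundTrip : ∀ y {b x} (W : Walk G b b) (p : Walk G b x) → y ≢ b →
    parity (visits y (W ++ʷ roundTrip p)) ≡ parity (visits y W) + parity (δ y x)
  parity-visits-++-roundTrip y {b} {x} W p y≢b = begin
    parity (visits y (W ++ʷ roundTrip p))
      ≡⟨ cong parity (visits-++ y W (roundTrip p)) ⟩
    parity (visits y W ℕ.+ visits y (roundTrip p))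
      ≡⟨ +-homo-+ (visits y W) (visits y (roundTrip p)) ⟩
    parity (visits y W) + parity (visits y (roundTrip p))
      ≡⟨ cong (parity (visits y W) +_) (parity-visits-roundTrip y p) ⟩
    parity (visits y W) + (parity (δ y b) + parity (δ y x))
      ≡⟨ cong (λ k → parity (visits y W) + (parity k + parity (δ y x))) (δ-≢ y≢b) ⟩
    parity (visits y W) + parity (δ y x)
      ∎
    where open ≡-Reasoning

  module _ (connected : Connected G) {b : Fin n} where

    distanceParity : Fin n → Parity
    distanceParity x = parity (length (connected b x))

    -- Colour by distanceParity: as G is not bipartite some edge u v is monochromatic,
    -- and b ⇝ u → v ⇝ b is then a closed walk of odd length.
    oddClosedWalk : ¬ Bipartite G → Σ (Walk G b b) λ W → parity (length W) ≡ 1ℙ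
    oddClosedWalk nonBipartite
      with any? (λ u → any? (λ v → (adj G u v Bool.≟ true) ×-dec (distanceParity u ℙ.≟ distanceParity v)))
    ... | no noMonochromaticEdge =
      ⊥-elim (nonBipartite (toBool ∘ distanceParity , λ u v e sameColour →
        noMonochromaticEdge (u , v , e , toBool-injective sameColour)))
    ... | yes (u , v , e , sameParity) = oddWalk , oddLength
      where
      open ≡-Reasoning
      χu : Parity
      χu = distanceParity u

      oddWalk : Walk G b b
      oddWalk = connected b u ++ʷ (u ∷⟨ e ⟩ reverse (connected b v))

      oddLength : parity (length oddWalk) ≡ 1ℙ
      oddLength = begin
        parity (length oddWalk)
          ≡⟨ cong parity (length-++ (connected b u) _) ⟩
        parity (length (connected b u) ℕ.+ suc (length (reverse (connected b v))))
          ≡⟨ +-homo-+ (length (connected b u)) _ ⟩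
        χu + parity (suc (length (reverse (connected b v))))
          ≡⟨ cong (χu +_) (+-homo-+ 1 (length (reverse (connected b v)))) ⟩
        χu + (1ℙ + parity (length (reverse (connected b v))))
          ≡⟨ cong (λ k → χu + (1ℙ + parity k)) (length-reverse (connected b v)) ⟩
        χu + (1ℙ + distanceParity v)
          ≡⟨ cong (λ q → χu + (1ℙ + q)) sameParity ⟨
        χu + (1ℙ + χu)
          ≡⟨ x∙yz≈y∙xz χu 1ℙ χu ⟩
        1ℙ + (χu + χu)
          ≡⟨ cong (1ℙ +_) (p+p≡0ℙ χu) ⟩
        1ℙ
          ∎

    oddVisitsOn : (xs : List (Fin n)) (W : Walk G b b) →
      Σ (Walk G b b) λ W′ → parity (length W′) ≡ parity (length W)
                           × (∀ x → x ∈ xs → x ≢ b → parity (visits x W′) ≡ 1ℙ)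
    oddVisitsOn []       W = W , refl , λ _ ()
    oddVisitsOn (x ∷ xs) W with oddVisitsOn xs W
    ... | W′ , sameLength , oddOnXs with parity (visits x W′) in visitsX
    ...   | 1ℙ = W′ , sameLength , oddOn
      where
      oddOn : ∀ y → y ∈ x ∷ xs → y ≢ b → parity (visits y W′) ≡ 1ℙ
      oddOn y (here refl)  y≢b = visitsX
      oddOn y (there y∈xs) y≢b = oddOnXs y y∈xs y≢b
    ...   | 0ℙ = W″ , sameLength′ , oddOn
      where
      W″ : Walk G b b
      W″ = W′ ++ʷ roundTrip (connected b x)

      sameLength′ : parity (length W″) ≡ parity (length W)
      sameLength′ = begin
        parity (length W″)
          ≡⟨ cong parity (length-++ W′ _) ⟩
        parity (length W′ ℕ.+ length (roundTrip (connected b x)))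
          ≡⟨ +-homo-+ (length W′) _ ⟩
        parity (length W′) + parity (length (roundTrip (connected b x)))
          ≡⟨ cong₂ _+_ sameLength (parity-length-roundTrip (connected b x)) ⟩
        parity (length W) + 0ℙ
          ≡⟨ ℙ.+-identityʳ _ ⟩
        parity (length W)
          ∎
        where open ≡-Reasoning

      toggled : ∀ y → y ≢ b → parity (visits y W″) ≡ parity (visits y W′) + parity (δ y x)
      toggled y = parity-visits-++-roundTrip y W′ (connected b x)

      x-fixed : x ≢ b → parity (visits x W″) ≡ 1ℙ
      x-fixed x≢b = trans (toggled x x≢b) (cong₂ _+_ visitsX (cong parity (δ-≡ x)))

      oddOn : ∀ y → y ∈ x ∷ xs → y ≢ b → parity (visits y W″) ≡ 1ℙ
      oddOn y (here refl)  = x-fixed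
      oddOn y (there y∈xs) y≢b with y ≟ x
      ... | yes refl = x-fixed y≢b
      ... | no y≢x   =
        trans (toggled y y≢b) (cong₂ _+_ (oddOnXs y y∈xs y≢b) (cong parity (δ-≢ y≢x)))

parityHamiltonianCycle-fromClosedWalk : ∀ {n} {G : Graph (suc n)} → Connected G →
  ∀ {b} (O : Walk G b b) → parity (length O) ≡ parity (suc n) → HasParityHamiltonianCycle G
parityHamiltonianCycle-fromClosedWalk {n} connected {b} O lengthParity
  with oddVisitsOn connected (allFin (suc n)) O
... | W , sameLength , oddOn = b , W , odd
  where
  oddOn′ : ∀ y → y ≢ b → parity (visits y W) ≡ 1ℙ
  oddOn′ y = oddOn y (∈-allFin y)

  b-odd : parity (visits b W) ≡ 1ℙ
  b-odd = +-cancelʳ-≡ (parity n) _ _ (begin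
    parity (visits b W) + parity n          ≡⟨ cong (parity (visits b W) +_) (*-identityʳ (parity n)) ⟨
    parity (visits b W) + (parity n * 1ℙ)   ≡⟨ ∑-constantExcept _ b 1ℙ oddOn′ ⟨
    ∑[ y < suc n ] parity (visits y W)      ≡⟨ ∑-parity-visits W ⟩
    parity (length W)                       ≡⟨ sameLength ⟩
    parity (length O)                       ≡⟨ lengthParity ⟩
    parity (suc n)                          ≡⟨ +-homo-+ 1 n ⟩
    1ℙ + parity n                           ∎)
    where open ≡-Reasoning

  odd : ∀ x → Odd (visits x W)
  odd x with x ≟ b
  ... | yes refl = parity≡1ℙ⇒odd b-odd
  ... | no x≢b   = parity≡1ℙ⇒odd (oddOn′ x x≢b)

theorem3p1 : (n : ℕ) (G : Graph (suc n)) → Connected G →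
    (HasParityHamiltonianCycle G ⇔ (Even (suc n) ⊎ ¬ Bipartite G))
theorem3p1 n G connected = mk⇔ necessary sufficient
  where
  necessary : HasParityHamiltonianCycle G → Even (suc n) ⊎ ¬ Bipartite G
  necessary (b , W , odd) with parity (suc n) in parityVertices
  ... | 0ℙ = inj₁ (parity≡0ℙ⇒even (suc n) parityVertices)
  ... | 1ℙ = inj₂ λ bipartite →
    case trans (sym parityVertices)
               (trans (sym (parity-length-oddVisits W odd))
                      (bipartite⇒parity-length-closed≡0ℙ bipartite W)) of λ ()

  startWalk : Even (suc n) ⊎ ¬ Bipartite G →
    Σ (Walk G zero zero) λ O → parity (length O) ≡ parity (suc n)
  startWalk (inj₁ even) = [ zero ] , sym (even⇒parity≡0ℙ even)
  startWalk (inj₂ nonBipartite) with parity (suc n)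
  ... | 0ℙ = [ zero ] , refl
  ... | 1ℙ = oddClosedWalk connected nonBipartite

  sufficient : Even (suc n) ⊎ ¬ Bipartite G → HasParityHamiltonianCycle G
  sufficient h with startWalk h
  ... | O , lengthParity = parityHamiltonianCycle-fromClosedWalk connected O lengthParity
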